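{- Let $m$ be a positive integer, $r$ a nonnegative integer, $\lambda\in\mathbb{R}$. For $n,k\in\mathbb{N}$ with $n\ge k$, $$W_{m,\lambda}^{(r)}(n+1,k)-(r-n\lambda)W_{m,\lambda}^{(r)}(n,k)=\sum_{l=k-1}^{n}\binom{n}{l}(m)_{n-l,\lambda}W_{m,\lambda}^{(r)}(l,k-1).$$
   Context: $(x)_{0,\lambda}=1$, $(x)_{n,\lambda}=x(x-\lambda)\cdots(x-(n-1)\lambda)$, $(x)_n=(x)_{n,1}$. The degenerate $r$-Whitney numbers of the second kind are defined by the polynomial identities $(mx+r)_{n,\lambda}=\sum_{k=0}^n W_{m,\lambda}^{(r)}(n,k)m^k(x)_k$, $n\ge0$, with $W_{m,\lambda}^{(r)}(n,k)=0$ for $k>n$. -}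

module Defs where

open import Level using (_⊔_)
open import Algebra.Bundles using (CommutativeRing)
open import Data.Nat using (ℕ; zero; suc; _∸_; _<_)
import Data.Nat as ℕ
open import Data.Sum using (_⊎_)
open import Data.Product using (_×_)
open import Relation.Binary.PropositionalEquality using (_≡_)

module _ {c ℓ} (R : CommutativeRing c ℓ) where
  open CommutativeRing R

  ι : ℕ → Carrier
  ι zero    = 0#
  ι (suc n) = 1# + ι n

  pow : Carrier → ℕ → Carrier
  pow x zero    = 1#
  pow x (suc n) = pow x n * x

  fallingλ : Carrier → Carrier → ℕ → Carrier
  fallingλ x lam zero    = 1#
  fallingλ x lam (suc n) = fallingλ x lam n * (x - ι n * lam)

  falling : Carrier → ℕ → Carrier
  falling x n = fallingλ x 1# n

  sumBelow : ℕ → (ℕ → Carrier) → Carrier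
  sumBelow zero    f = 0#
  sumBelow (suc n) f = sumBelow n f + f n

  -- Σ_{i=a}^{b} f i  (empty when b < a)
  sumFromTo : ℕ → ℕ → (ℕ → Carrier) → Carrier
  sumFromTo a b f = sumBelow (suc b ∸ a) (λ i → f (a ℕ.+ i))

  CharacteristicZero : Set ℓ
  CharacteristicZero = ∀ n → ι n ≈ 0# → n ≡ 0

  NoZeroDivisors : Set (c ⊔ ℓ)
  NoZeroDivisors = ∀ x y → x * y ≈ 0# → (x ≈ 0#) ⊎ (y ≈ 0#)

  -- W is the family of degenerate r-Whitney numbers of the second kind:
  -- (m x + r)_{n,λ} = Σ_{k=0}^{n} W(n,k) m^k (x)_k for all x, and W(n,k) = 0 for k > n.
  IsDegWhitney2 : ℕ → ℕ → Carrier → (ℕ → ℕ → Carrier) → Set (c ⊔ ℓ)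
  IsDegWhitney2 m r lam W =
    (∀ n x → fallingλ (ι m * x + ι r) lam n
               ≈ sumBelow (suc n) (λ k → W n k * pow (ι m) k * falling x k))
    × (∀ n k → n < k → W n k ≈ 0#)

  -- W(l, k-1), with the convention W(l, -1) = 0
  Wpred : (ℕ → ℕ → Carrier) → ℕ → ℕ → Carrier
  Wpred W l zero    = 0#
  Wpred W l (suc j) = W l j

-- Write P x = m x + r. On one side (P x)_{n+1,λ} − (r − nλ)(P x)_{n,λ} = m x (P x)_{n,λ}.
-- On the other side P x = P (x − 1) + m, so the degenerate Vandermonde identity
-- expands (P x)_{n,λ} = Σ_l C(n,l) (m)_{n−l,λ} (P (x − 1))_{l,λ}, and the defining
-- expansion of (P (x − 1))_{l,λ} together with x (x − 1)_j = (x)_{j+1} writes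
-- m x (P x)_{n,λ} in the basis m^k (x)_k with exactly the coefficients on the right.
-- Both sides are therefore expansions of the same polynomial in the falling factorials
-- (x)_k, which are linearly independent in characteristic zero (evaluate at x = 0, 1, 2, …);
-- comparing coefficients and cancelling m^k ≠ 0 gives the identity.
module Submission where

open import Defs
open import Algebra.Bundles using (CommutativeRing)
open import Data.Nat using (ℕ; zero; suc; _∸_; _≤_; _<_; z≤n; s≤s; _!)
import Data.Nat as ℕ
import Data.Nat.Properties as ℕ
open import Data.Nat.Combinatorics using (_C_; k>n⇒nCk≡0; nCk+nC[k+1]≡[n+1]C[k+1])
open import Data.Nat.Induction using (<-rec)
open import Data.Product using (proj₁; proj₂)
open import Data.Sum using (inj₁; inj₂)
open import Function using (_∘_)
open import Relation.Nullary using (¬_; contradiction)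
open import Relation.Binary.Definitions using (tri<; tri≈; tri>)
open import Relation.Binary.PropositionalEquality as ≡ using (_≡_; _≢_)

module _ {c ℓ} (R : CommutativeRing c ℓ) where
  open CommutativeRing R
  open import Algebra.Properties.Ring ring using (x[y-z]≈xy-xz; [y-z]x≈yx-zx)
  open import Algebra.Properties.AbelianGroup +-abelianGroup using (⁻¹-∙-comm)
  open import Algebra.Properties.CommutativeSemigroup +-commutativeSemigroup
    using (interchange; x∙yz≈y∙xz)
  open import Algebra.Properties.Group +-group
    using (ε⁻¹≈ε; x∙y⁻¹≈ε⇒x≈y; x≈y⇒x∙y⁻¹≈ε; //-rightDividesˡ; //-rightDividesʳ)
  open import Algebra.Properties.Semiring.Mult semiring using (_×_; ×-homo-+; ×1-homo-*)
  open import Algebra.Solver.Ring.NaturalCoefficients.Default commutativeSemiring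
  open import Relation.Binary.Reasoning.Setoid setoid

  Σ< : ℕ → (ℕ → Carrier) → Carrier
  Σ< = sumBelow R

  ι≡×1# : ∀ n → ι R n ≡ n × 1#
  ι≡×1# zero    = ≡.refl
  ι≡×1# (suc n) = ≡.cong (1# +_) (ι≡×1# n)

  ι-homo-+ : ∀ m n → ι R (m ℕ.+ n) ≈ ι R m + ι R n
  ι-homo-+ m n rewrite ι≡×1# (m ℕ.+ n) | ι≡×1# m | ι≡×1# n = ×-homo-+ 1# m n

  ι-homo-* : ∀ m n → ι R (m ℕ.* n) ≈ ι R m * ι R n
  ι-homo-* m n rewrite ι≡×1# (m ℕ.* n) | ι≡×1# m | ι≡×1# n = ×1-homo-* m n

  x*y≈0⇒x≈0 : NoZeroDivisors R → ∀ {x y} → ¬ y ≈ 0# → x * y ≈ 0# → x ≈ 0#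
  x*y≈0⇒x≈0 nzd y≉0 xy≈0 with nzd _ _ xy≈0
  ... | inj₁ x≈0 = x≈0
  ... | inj₂ y≈0 = contradiction y≈0 y≉0

  *-cancelʳ-≉0 : NoZeroDivisors R → ∀ {x y z} → ¬ z ≈ 0# → x * z ≈ y * z → x ≈ y
  *-cancelʳ-≉0 nzd z≉0 xz≈yz = x∙y⁻¹≈ε⇒x≈y _ _
    (x*y≈0⇒x≈0 nzd z≉0 (trans ([y-z]x≈yx-zx _ _ _) (x≈y⇒x∙y⁻¹≈ε xz≈yz)))

  pow-≉0 : NoZeroDivisors R → ∀ {x} → ¬ x ≈ 0# → ∀ k → ¬ pow R x k ≈ 0#
  pow-≉0 nzd {x} x≉0 zero 1≈0 = x≉0 (begin
    x       ≈⟨ *-identityʳ x ⟨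
    x * 1#  ≈⟨ *-congˡ 1≈0 ⟩
    x * 0#  ≈⟨ zeroʳ x ⟩
    0#      ∎)
  pow-≉0 nzd x≉0 (suc k) = pow-≉0 nzd x≉0 k ∘ x*y≈0⇒x≈0 nzd x≉0

  Σ<-cong : ∀ N {f g : ℕ → Carrier} → (∀ i → i < N → f i ≈ g i) → Σ< N f ≈ Σ< N g
  Σ<-cong zero    f≈g = refl
  Σ<-cong (suc N) f≈g =
    +-cong (Σ<-cong N (λ i i<N → f≈g i (ℕ.m<n⇒m<1+n i<N))) (f≈g N (ℕ.n<1+n N))

  Σ<-zero : ∀ N {f : ℕ → Carrier} → (∀ i → i < N → f i ≈ 0#) → Σ< N f ≈ 0#
  Σ<-zero zero    f≈0 = refl
  Σ<-zero (suc N) f≈0 = trans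
    (+-cong (Σ<-zero N (λ i i<N → f≈0 i (ℕ.m<n⇒m<1+n i<N))) (f≈0 N (ℕ.n<1+n N)))
    (+-identityʳ 0#)

  Σ<-distrib-+ : ∀ N (f g : ℕ → Carrier) → Σ< N (λ i → f i + g i) ≈ Σ< N f + Σ< N g
  Σ<-distrib-+ zero    f g = sym (+-identityʳ 0#)
  Σ<-distrib-+ (suc N) f g = trans (+-congʳ (Σ<-distrib-+ N f g)) (interchange _ _ _ _)

  Σ<-distrib-sub : ∀ N (f g : ℕ → Carrier) → Σ< N (λ i → f i - g i) ≈ Σ< N f - Σ< N g
  Σ<-distrib-sub zero    f g = sym (trans (+-congˡ ε⁻¹≈ε) (+-identityʳ 0#))
  Σ<-distrib-sub (suc N) f g = trans (+-congʳ (Σ<-distrib-sub N f g))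
    (trans (interchange _ _ _ _) (+-congˡ (⁻¹-∙-comm _ _)))

  Σ<-distribˡ-* : ∀ N a (f : ℕ → Carrier) → a * Σ< N f ≈ Σ< N (λ i → a * f i)
  Σ<-distribˡ-* zero    a f = zeroʳ a
  Σ<-distribˡ-* (suc N) a f = trans (distribˡ a _ _) (+-congʳ (Σ<-distribˡ-* N a f))

  Σ<-distribʳ-* : ∀ N a (f : ℕ → Carrier) → Σ< N f * a ≈ Σ< N (λ i → f i * a)
  Σ<-distribʳ-* zero    a f = zeroˡ a
  Σ<-distribʳ-* (suc N) a f = trans (distribʳ a _ _) (+-congʳ (Σ<-distribʳ-* N a f))

  Σ<-comm : ∀ A B (g : ℕ → ℕ → Carrier) →
            Σ< A (λ i → Σ< B (g i)) ≈ Σ< B (λ j → Σ< A (λ i → g i j))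
  Σ<-comm zero    B g = sym (Σ<-zero B (λ _ _ → refl))
  Σ<-comm (suc A) B g = trans (+-congʳ (Σ<-comm A B g)) (sym (Σ<-distrib-+ B _ (g A)))

  Σ<-suc : ∀ N (f : ℕ → Carrier) → Σ< (suc N) f ≈ f 0 + Σ< N (f ∘ suc)
  Σ<-suc zero    f = trans (+-identityˡ _) (sym (+-identityʳ _))
  Σ<-suc (suc N) f = trans (+-congʳ (Σ<-suc N f)) (+-assoc _ _ _)

  Σ<-extend : ∀ {M} N (f : ℕ → Carrier) → M ≤ N → (∀ j → M ≤ j → j < N → f j ≈ 0#) →
              Σ< M f ≈ Σ< N f
  Σ<-extend zero    f z≤n   _   = refl
  Σ<-extend {M} (suc N) f M≤1+N f≈0 with ℕ.m≤n⇒m<n∨m≡n M≤1+N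
  ... | inj₂ ≡.refl  = refl
  ... | inj₁ (s≤s M≤N) = begin
    Σ< M f          ≈⟨ Σ<-extend N f M≤N (λ j M≤j j<N → f≈0 j M≤j (ℕ.m<n⇒m<1+n j<N)) ⟩
    Σ< N f          ≈⟨ +-identityʳ _ ⟨
    Σ< N f + 0#     ≈⟨ +-congˡ (f≈0 N M≤N (ℕ.n<1+n N)) ⟨
    Σ< (suc N) f    ∎

  Σ<-drop-prefix : ∀ a t (f : ℕ → Carrier) → (∀ i → i < a → f i ≈ 0#) →
                   Σ< t (λ i → f (a ℕ.+ i)) ≈ Σ< (t ℕ.+ a) f
  Σ<-drop-prefix a zero    f f≈0 = sym (Σ<-zero a f≈0)
  Σ<-drop-prefix a (suc t) f f≈0 =
    +-cong (Σ<-drop-prefix a t f f≈0) (reflexive (≡.cong f (ℕ.+-comm a t)))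

  sumFromTo≈Σ< : ∀ a b (f : ℕ → Carrier) → a ≤ suc b → (∀ i → i < a → f i ≈ 0#) →
                 sumFromTo R a b f ≈ Σ< (suc b) f
  sumFromTo≈Σ< a b f a≤1+b f≈0 = trans (Σ<-drop-prefix a (suc b ∸ a) f f≈0)
    (reflexive (≡.cong (λ N → Σ< N f) (ℕ.m∸n+n≡m a≤1+b)))

  Σ<-single : ∀ N k (f : ℕ → Carrier) → k < N → (∀ i → i < N → i ≢ k → f i ≈ 0#) →
              Σ< N f ≈ f k
  Σ<-single (suc N) k f k<1+N f≈0 with ℕ.m<1+n⇒m<n∨m≡n k<1+N
  ... | inj₁ k<N = trans
    (+-cong (Σ<-single N k f k<N (λ i i<N → f≈0 i (ℕ.m<n⇒m<1+n i<N)))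
            (f≈0 N (ℕ.n<1+n N) (ℕ.<⇒≢ k<N ∘ ≡.sym)))
    (+-identityʳ _)
  ... | inj₂ ≡.refl = trans
    (+-congʳ (Σ<-zero N (λ i i<N → f≈0 i (ℕ.m<n⇒m<1+n i<N) (ℕ.<⇒≢ i<N))))
    (+-identityˡ _)

  fallingλ-cong : ∀ lam n {x y} → x ≈ y → fallingλ R x lam n ≈ fallingλ R y lam n
  fallingλ-cong lam zero    x≈y = refl
  fallingλ-cong lam (suc n) x≈y = *-cong (fallingλ-cong lam n x≈y) (+-congʳ x≈y)

  fallingλ-suc : ∀ x lam n → fallingλ R x lam (suc n) ≈ x * fallingλ R (x - lam) lam n
  fallingλ-suc x lam zero = begin
    1# * (x - 0# * lam)  ≈⟨ *-identityˡ _ ⟩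
    x - 0# * lam         ≈⟨ +-congˡ (trans (-‿cong (zeroˡ lam)) ε⁻¹≈ε) ⟩
    x + 0#               ≈⟨ +-identityʳ x ⟩
    x                    ≈⟨ *-identityʳ x ⟨
    x * 1#               ∎
  fallingλ-suc x lam (suc n) = begin
    fallingλ R x lam (suc n) * (x - ι R (suc n) * lam)
      ≈⟨ *-cong (fallingλ-suc x lam n) shift ⟩
    x * fallingλ R (x - lam) lam n * ((x - lam) - ι R n * lam)
      ≈⟨ *-assoc x _ _ ⟩
    x * fallingλ R (x - lam) lam (suc n) ∎
    where
    shift : x - ι R (suc n) * lam ≈ (x - lam) - ι R n * lam
    shift = begin
      x - (1# + ι R n) * lam         ≈⟨ +-congˡ (-‿cong (distribʳ lam 1# (ι R n))) ⟩
      x - (1# * lam + ι R n * lam)   ≈⟨ +-congˡ (-‿cong (+-congʳ (*-identityˡ lam))) ⟩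
      x - (lam + ι R n * lam)        ≈⟨ +-congˡ (⁻¹-∙-comm lam _) ⟨
      x + (- lam - ι R n * lam)      ≈⟨ +-assoc x (- lam) _ ⟨
      (x - lam) - ι R n * lam        ∎

  falling-ι-vanishes : ∀ {k i} → k < i → falling R (ι R k) i ≈ 0#
  falling-ι-vanishes {k} {suc i} k<1+i with ℕ.m<1+n⇒m<n∨m≡n k<1+i
  ... | inj₁ k<i    = trans (*-congʳ (falling-ι-vanishes k<i)) (zeroˡ _)
  ... | inj₂ ≡.refl =
    trans (*-congˡ (trans (+-congˡ (-‿cong (*-identityʳ _))) (-‿inverseʳ _))) (zeroʳ _)

  falling-ι-diagonal : ∀ k → falling R (ι R k) k ≈ ι R (k !)
  falling-ι-diagonal zero    = sym (+-identityʳ 1#)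
  falling-ι-diagonal (suc k) = begin
    falling R (ι R (suc k)) (suc k)               ≈⟨ fallingλ-suc _ 1# k ⟩
    ι R (suc k) * falling R (ι R (suc k) - 1#) k  ≈⟨ *-congˡ (fallingλ-cong 1# k pred) ⟩
    ι R (suc k) * falling R (ι R k) k             ≈⟨ *-congˡ (falling-ι-diagonal k) ⟩
    ι R (suc k) * ι R (k !)                       ≈⟨ ι-homo-* (suc k) (k !) ⟨
    ι R (suc k !)                                 ∎
    where
    pred : ι R (suc k) - 1# ≈ ι R k
    pred = trans (+-congʳ (+-comm 1# (ι R k))) (//-rightDividesʳ 1# (ι R k))

  -- Evaluating at x = k kills every (x)_i with i > k, and the coefficients below k vanish
  -- by induction, leaving e_k · k! = 0.
  falling-coefficients-zero : CharacteristicZero R → NoZeroDivisors R →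
    ∀ N (e : ℕ → Carrier) → (∀ x → Σ< N (λ i → e i * falling R x i) ≈ 0#) →
    ∀ k → k < N → e k ≈ 0#
  falling-coefficients-zero char0 nzd N e Σ≈0 = <-rec _ step
    where
    step : ∀ k → (∀ {i} → i < k → i < N → e i ≈ 0#) → k < N → e k ≈ 0#
    step k below k<N = x*y≈0⇒x≈0 nzd k!≉0 (begin
      e k * ι R (k !)                         ≈⟨ *-congˡ (falling-ι-diagonal k) ⟨
      e k * falling R (ι R k) k               ≈⟨ Σ<-single N k _ k<N off-diagonal ⟨
      Σ< N (λ i → e i * falling R (ι R k) i)  ≈⟨ Σ≈0 (ι R k) ⟩
      0#                                      ∎)
      where
      k!≉0 : ¬ ι R (k !) ≈ 0#
      k!≉0 = ℕ.≢-nonZero⁻¹ (k !) {{ℕ._!≢0 k}} ∘ char0 (k !)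
      off-diagonal : ∀ i → i < N → i ≢ k → e i * falling R (ι R k) i ≈ 0#
      off-diagonal i i<N i≢k with ℕ.<-cmp i k
      ... | tri< i<k _ _ = trans (*-congʳ (below i<k i<N)) (zeroˡ _)
      ... | tri≈ _ i≡k _ = contradiction i≡k i≢k
      ... | tri> _ _ k<i = trans (*-congˡ (falling-ι-vanishes k<i)) (zeroʳ _)

  falling-coefficients-unique : CharacteristicZero R → NoZeroDivisors R →
    ∀ N (a b : ℕ → Carrier) →
    (∀ x → Σ< N (λ i → a i * falling R x i) ≈ Σ< N (λ i → b i * falling R x i)) →
    ∀ k → k < N → a k ≈ b k
  falling-coefficients-unique char0 nzd N a b Σa≈Σb k k<N =
    x∙y⁻¹≈ε⇒x≈y _ _ (falling-coefficients-zero char0 nzd N (λ i → a i - b i) Σ≈0 k k<N)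
    where
    Σ≈0 : ∀ x → Σ< N (λ i → (a i - b i) * falling R x i) ≈ 0#
    Σ≈0 x = begin
      Σ< N (λ i → (a i - b i) * falling R x i)
        ≈⟨ Σ<-cong N (λ i _ → [y-z]x≈yx-zx _ _ _) ⟩
      Σ< N (λ i → a i * falling R x i - b i * falling R x i)
        ≈⟨ Σ<-distrib-sub N _ _ ⟩
      Σ< N (λ i → a i * falling R x i) - Σ< N (λ i → b i * falling R x i)
        ≈⟨ x≈y⇒x∙y⁻¹≈ε (Σa≈Σb x) ⟩
      0# ∎

  module DegenerateFalling (lam : Carrier) where

    infixl 8 _↓_
    _↓_ : Carrier → ℕ → Carrier
    x ↓ n = fallingλ R x lam n

    -- The n-th factor of (a + b)_{n+1,λ} splits as (a − lλ) + (b − (n − l)λ), extending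
    -- (a)_{l,λ} and (b)_{n−l,λ} respectively; Pascal's rule then recombines the two sums.
    ↓-vandermonde : ∀ a b n → (a + b) ↓ n ≈ Σ< (suc n) (λ l → ι R (n C l) * b ↓ (n ∸ l) * a ↓ l)
    ↓-vandermonde a b zero =
      sym (trans (+-identityˡ _) (trans (*-identityʳ _) (trans (*-identityʳ _) (+-identityʳ 1#))))
    ↓-vandermonde a b (suc n) = begin
      (a + b) ↓ n * (a + b - ι R n * lam)             ≈⟨ *-congʳ (↓-vandermonde a b n) ⟩
      Σ< (suc n) t * (a + b - ι R n * lam)            ≈⟨ Σ<-distribʳ-* (suc n) _ t ⟩
      Σ< (suc n) (λ l → t l * (a + b - ι R n * lam))  ≈⟨ Σ<-cong (suc n) split ⟩
      Σ< (suc n) (λ l → u l + v l)                    ≈⟨ Σ<-distrib-+ (suc n) u v ⟩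
      Σ< (suc n) u + Σ< (suc n) v                     ≈⟨ +-congˡ v-shift ⟩
      Σ< (suc n) u + (v 0 + Σ< (suc n) (v ∘ suc))     ≈⟨ x∙yz≈y∙xz _ _ _ ⟩
      v 0 + (Σ< (suc n) u + Σ< (suc n) (v ∘ suc))     ≈⟨ +-congˡ (Σ<-distrib-+ (suc n) u _) ⟨
      v 0 + Σ< (suc n) (λ l → u l + v (suc l))        ≈⟨ +-congˡ (Σ<-cong (suc n) pascal) ⟩
      v 0 + Σ< (suc n) (t′ ∘ suc)                     ≈⟨ Σ<-suc (suc n) t′ ⟨
      Σ< (suc (suc n)) t′                             ∎
      where
      -- v 0 and t′ 0 agree definitionally: n C 0 and suc n C 0 both compute to 1.
      t t′ u v : ℕ → Carrier
      t l  = ι R (n C l) * b ↓ (n ∸ l) * a ↓ l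
      t′ l = ι R (suc n C l) * b ↓ (suc n ∸ l) * a ↓ l
      u l  = ι R (n C l) * b ↓ (n ∸ l) * a ↓ suc l
      v l  = ι R (n C l) * b ↓ (suc n ∸ l) * a ↓ l

      factor-split : ∀ p q → (a + b) - (p + q) * lam ≈ (a - p * lam) + (b - q * lam)
      factor-split p q = begin
        (a + b) - (p + q) * lam              ≈⟨ +-congˡ (-‿cong (distribʳ lam p q)) ⟩
        (a + b) - (p * lam + q * lam)        ≈⟨ +-congˡ (⁻¹-∙-comm _ _) ⟨
        (a + b) + (- (p * lam) - q * lam)    ≈⟨ interchange a b _ _ ⟩
        (a - p * lam) + (b - q * lam)        ∎

      split : ∀ l → l < suc n → t l * (a + b - ι R n * lam) ≈ u l + v l
      split l (s≤s l≤n) = begin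
        K * B * A * (a + b - ι R n * lam)
          ≈⟨ *-congˡ (+-congˡ (-‿cong (*-congʳ ι-n))) ⟩
        K * B * A * (a + b - (ι R l + ι R (n ∸ l)) * lam)
          ≈⟨ *-congˡ (factor-split (ι R l) (ι R (n ∸ l))) ⟩
        K * B * A * (X + Y)
          ≈⟨ solve 5 (λ K B A X Y → K :* B :* A :* (X :+ Y)
                                    := K :* B :* (A :* X) :+ K :* (B :* Y) :* A) refl K B A X Y ⟩
        u l + K * b ↓ suc (n ∸ l) * A
          ≡⟨ ≡.cong (λ j → u l + K * b ↓ j * A) (ℕ.+-∸-assoc 1 l≤n) ⟨
        u l + v l ∎
        where
        K = ι R (n C l)
        B = b ↓ (n ∸ l)
        A = a ↓ l
        X = a - ι R l * lam
        Y = b - ι R (n ∸ l) * lam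
        ι-n : ι R n ≈ ι R l + ι R (n ∸ l)
        ι-n = trans (reflexive (≡.cong (ι R) (≡.sym (ℕ.m+[n∸m]≡n l≤n)))) (ι-homo-+ l (n ∸ l))

      v-shift : Σ< (suc n) v ≈ v 0 + Σ< (suc n) (v ∘ suc)
      v-shift = trans (Σ<-extend (suc (suc n)) v (ℕ.n≤1+n _) v-vanishes) (Σ<-suc (suc n) v)
        where
        v-vanishes : ∀ j → suc n ≤ j → j < suc (suc n) → v j ≈ 0#
        v-vanishes j n<j _ = begin
          v j                           ≡⟨ ≡.cong (λ i → ι R i * B * A) (k>n⇒nCk≡0 n<j) ⟩
          0# * B * A                    ≈⟨ *-congʳ (zeroˡ B) ⟩
          0# * A                        ≈⟨ zeroˡ A ⟩
          0#                            ∎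
          where
          B = b ↓ (suc n ∸ j)
          A = a ↓ j

      pascal : ∀ l → l < suc n → u l + v (suc l) ≈ t′ (suc l)
      pascal l _ = begin
        ι R (n C l) * B * A + ι R (n C suc l) * B * A   ≈⟨ distribʳ A _ _ ⟨
        (ι R (n C l) * B + ι R (n C suc l) * B) * A     ≈⟨ *-congʳ (distribʳ B _ _) ⟨
        (ι R (n C l) + ι R (n C suc l)) * B * A
          ≈⟨ *-congʳ (*-congʳ (ι-homo-+ (n C l) (n C suc l))) ⟨
        ι R (n C l ℕ.+ n C suc l) * B * A
          ≡⟨ ≡.cong (λ i → ι R i * B * A) (nCk+nC[k+1]≡[n+1]C[k+1] n l) ⟩
        ι R (suc n C suc l) * B * A                     ∎
        where
        B = b ↓ (n ∸ l)
        A = a ↓ suc l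

  module Whitney (m r : ℕ) (lam : Carrier) (W : ℕ → ℕ → Carrier)
                 (isWhitney : IsDegWhitney2 R m r lam W) (n : ℕ) where
    open DegenerateFalling lam

    M : Carrier
    M = ι R m

    W-expansion : ∀ {l} N x → l < N →
      (M * x + ι R r) ↓ l ≈ Σ< N (λ k → W l k * pow R M k * falling R x k)
    W-expansion {l} N x l<N = trans (proj₁ isWhitney l x) (Σ<-extend N _ l<N vanishing)
      where
      vanishing : ∀ k → suc l ≤ k → k < N → W l k * pow R M k * falling R x k ≈ 0#
      vanishing k l<k _ = trans (*-congʳ (trans (*-congʳ (proj₂ isWhitney l k l<k)) (zeroˡ _)))
                                (zeroˡ _)

    Wpred-vanishes : ∀ {l} k → l < k ∸ 1 → Wpred R W l k ≈ 0#
    Wpred-vanishes zero    _   = refl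
    Wpred-vanishes (suc k) l<k = proj₂ isWhitney _ k l<k

    coeff : ℕ → Carrier
    coeff l = ι R (n C l) * M ↓ (n ∸ l)

    S : ℕ → Carrier
    S j = Σ< (suc n) (λ l → coeff l * W l j)

    -- rhs k is the right-hand side summed over all l ≤ n; rhs (suc j) is S j by definition.
    lhs rhs : ℕ → Carrier
    lhs k = W (suc n) k - (ι R r - ι R n * lam) * W n k
    rhs k = Σ< (suc n) (λ l → coeff l * Wpred R W l k)

    shifted-expansion : ∀ y →
      (M * y + ι R r + M) ↓ n ≈ Σ< (suc n) (λ j → S j * pow R M j * falling R y j)
    shifted-expansion y = begin
      (M * y + ι R r + M) ↓ n
        ≈⟨ ↓-vandermonde (M * y + ι R r) M n ⟩
      Σ< (suc n) (λ l → coeff l * (M * y + ι R r) ↓ l)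
        ≈⟨ Σ<-cong (suc n) (λ l l<1+n → *-congˡ (W-expansion (suc n) y l<1+n)) ⟩
      Σ< (suc n) (λ l → coeff l * Σ< (suc n) (λ j → W l j * pow R M j * falling R y j))
        ≈⟨ Σ<-cong (suc n) (λ l _ → Σ<-distribˡ-* (suc n) (coeff l) _) ⟩
      Σ< (suc n) (λ l → Σ< (suc n) (λ j → coeff l * (W l j * pow R M j * falling R y j)))
        ≈⟨ Σ<-comm (suc n) (suc n) _ ⟩
      Σ< (suc n) (λ j → Σ< (suc n) (λ l → coeff l * (W l j * pow R M j * falling R y j)))
        ≈⟨ Σ<-cong (suc n) (λ j _ → Σ<-cong (suc n) (λ l _ → reassoc (coeff l) (W l j) _ _)) ⟩
      Σ< (suc n) (λ j → Σ< (suc n) (λ l → coeff l * W l j * P j))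
        ≈⟨ Σ<-cong (suc n) (λ j _ → Σ<-distribʳ-* (suc n) (P j) _) ⟨
      Σ< (suc n) (λ j → S j * P j)
        ≈⟨ Σ<-cong (suc n) (λ j _ → *-assoc _ _ _) ⟨
      Σ< (suc n) (λ j → S j * pow R M j * falling R y j) ∎
      where
      P : ℕ → Carrier
      P j = pow R M j * falling R y j
      reassoc : ∀ c w p f → c * (w * p * f) ≈ c * w * (p * f)
      reassoc = solve 4 (λ c w p f → c :* (w :* p :* f) := c :* w :* (p :* f)) refl

    times-x-expansion : ∀ x →
      x * (M * x + ι R r) ↓ n ≈ Σ< (suc n) (λ j → S j * pow R M j * falling R x (suc j))
    times-x-expansion x = begin
      x * (M * x + ι R r) ↓ n
        ≈⟨ *-congˡ (fallingλ-cong lam n (sym unshift)) ⟩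
      x * (M * (x - 1#) + ι R r + M) ↓ n
        ≈⟨ *-congˡ (shifted-expansion (x - 1#)) ⟩
      x * Σ< (suc n) (λ j → S j * pow R M j * falling R (x - 1#) j)
        ≈⟨ Σ<-distribˡ-* (suc n) x _ ⟩
      Σ< (suc n) (λ j → x * (S j * pow R M j * falling R (x - 1#) j))
        ≈⟨ Σ<-cong (suc n) (λ j _ → pull-x (S j * pow R M j)) ⟩
      Σ< (suc n) (λ j → S j * pow R M j * (x * falling R (x - 1#) j))
        ≈⟨ Σ<-cong (suc n) (λ j _ → *-congˡ (fallingλ-suc x 1# j)) ⟨
      Σ< (suc n) (λ j → S j * pow R M j * falling R x (suc j)) ∎
      where
      pull-x : ∀ {f} s → x * (s * f) ≈ s * (x * f)
      pull-x {f} s = solve 3 (λ x s f → x :* (s :* f) := s :* (x :* f)) refl x s f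
      unshift : M * (x - 1#) + ι R r + M ≈ M * x + ι R r
      unshift = begin
        M * (x - 1#) + ι R r + M
          ≈⟨ +-congʳ (+-congʳ (trans (x[y-z]≈xy-xz M x 1#) (+-congˡ (-‿cong (*-identityʳ M))))) ⟩
        (M * x - M) + ι R r + M
          ≈⟨ +-congʳ (solve 3 (λ Mx nM r → Mx :+ nM :+ r := Mx :+ r :+ nM) refl (M * x) (- M) (ι R r)) ⟩
        (M * x + ι R r) - M + M
          ≈⟨ //-rightDividesˡ M (M * x + ι R r) ⟩
        M * x + ι R r ∎

    lhs-expansion : ∀ x →
      Σ< (suc (suc n)) (λ k → lhs k * pow R M k * falling R x k) ≈ M * (x * (M * x + ι R r) ↓ n)
    lhs-expansion x = begin
      Σ< N (λ k → lhs k * pow R M k * falling R x k)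
        ≈⟨ Σ<-cong N (λ k _ → *-assoc (lhs k) (pow R M k) (falling R x k)) ⟩
      Σ< N (λ k → lhs k * Q k)
        ≈⟨ Σ<-cong N (λ k _ → trans ([y-z]x≈yx-zx (Q k) (W (suc n) k) (B * W n k))
                                     (+-congˡ (-‿cong (*-assoc B (W n k) (Q k))))) ⟩
      Σ< N (λ k → W (suc n) k * Q k - B * (W n k * Q k))
        ≈⟨ Σ<-distrib-sub N (λ k → W (suc n) k * Q k) (λ k → B * (W n k * Q k)) ⟩
      Σ< N (λ k → W (suc n) k * Q k) - Σ< N (λ k → B * (W n k * Q k))
        ≈⟨ +-congˡ (-‿cong (Σ<-distribˡ-* N B (λ k → W n k * Q k))) ⟨
      Σ< N (λ k → W (suc n) k * Q k) - B * Σ< N (λ k → W n k * Q k)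
        ≈⟨ +-cong (Σ<-cong N (λ k _ → reassoc (W (suc n) k) k))
                  (-‿cong (*-congˡ (Σ<-cong N (λ k _ → reassoc (W n k) k)))) ⟩
      Σ< N (λ k → W (suc n) k * pow R M k * falling R x k)
        - B * Σ< N (λ k → W n k * pow R M k * falling R x k)
        ≈⟨ +-cong (sym (proj₁ isWhitney (suc n) x))
                  (-‿cong (*-congˡ (sym (W-expansion N x (ℕ.m<n⇒m<1+n (ℕ.n<1+n n)))))) ⟩
      Fn * (Px - ι R n * lam) - B * Fn
        ≈⟨ +-congʳ expand-last-factor ⟩
      M * (x * Fn) + B * Fn - B * Fn
        ≈⟨ //-rightDividesʳ (B * Fn) (M * (x * Fn)) ⟩
      M * (x * Fn) ∎
      where
      N = suc (suc n)
      B = ι R r - ι R n * lam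
      Px = M * x + ι R r
      Fn = Px ↓ n
      Q : ℕ → Carrier
      Q k = pow R M k * falling R x k
      reassoc : ∀ w k → w * Q k ≈ w * pow R M k * falling R x k
      reassoc w k = sym (*-assoc w (pow R M k) (falling R x k))
      expand-last-factor : Fn * (Px - ι R n * lam) ≈ M * (x * Fn) + B * Fn
      expand-last-factor =
        solve 5 (λ F M x r q → F :* (M :* x :+ r :+ q) := M :* (x :* F) :+ (r :+ q) :* F)
              refl Fn M x (ι R r) (- (ι R n * lam))

    rhs-expansion : ∀ x →
      Σ< (suc (suc n)) (λ k → rhs k * pow R M k * falling R x k) ≈ M * (x * (M * x + ι R r) ↓ n)
    rhs-expansion x = begin
      Σ< (suc (suc n)) (λ k → rhs k * pow R M k * falling R x k)
        ≈⟨ Σ<-suc (suc n) _ ⟩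
      rhs 0 * 1# * 1# + Σ< (suc n) (λ j → S j * (pow R M j * M) * falling R x (suc j))
        ≈⟨ +-cong rhs₀≈0 (Σ<-cong (suc n) (λ j _ → pull-M (S j) (pow R M j) _)) ⟩
      0# + Σ< (suc n) (λ j → M * (S j * pow R M j * falling R x (suc j)))
        ≈⟨ +-identityˡ _ ⟩
      Σ< (suc n) (λ j → M * (S j * pow R M j * falling R x (suc j)))
        ≈⟨ Σ<-distribˡ-* (suc n) M _ ⟨
      M * Σ< (suc n) (λ j → S j * pow R M j * falling R x (suc j))
        ≈⟨ *-congˡ (times-x-expansion x) ⟨
      M * (x * (M * x + ι R r) ↓ n) ∎
      where
      pull-M : ∀ s p f → s * (p * M) * f ≈ M * (s * p * f)
      pull-M s p f = solve 4 (λ s p M f → s :* (p :* M) :* f := M :* (s :* p :* f)) refl s p M f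
      rhs₀≈0 : rhs 0 * 1# * 1# ≈ 0#
      rhs₀≈0 = trans (*-congʳ (trans (*-congʳ (Σ<-zero (suc n) (λ l _ → zeroʳ _))) (zeroˡ _)))
                     (zeroˡ _)

    lhs≈rhs : CharacteristicZero R → NoZeroDivisors R → 1 ≤ m →
              ∀ k → k < suc (suc n) → lhs k ≈ rhs k
    lhs≈rhs char0 nzd 1≤m k k<N = *-cancelʳ-≉0 nzd (pow-≉0 nzd M≉0 k)
      (falling-coefficients-unique char0 nzd (suc (suc n)) _ _
        (λ x → trans (lhs-expansion x) (sym (rhs-expansion x))) k k<N)
      where
      M≉0 : ¬ M ≈ 0#
      M≉0 = ℕ.<⇒≢ 1≤m ∘ ≡.sym ∘ char0 m

theorem16 : ∀ {c ℓ} (R : CommutativeRing c ℓ) → CharacteristicZero R → NoZeroDivisors R →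
    (m : ℕ) → 1 ≤ m → (r : ℕ) → (lam : CommutativeRing.Carrier R) →
    (W : ℕ → ℕ → CommutativeRing.Carrier R) → IsDegWhitney2 R m r lam W →
    (n k : ℕ) → k ≤ n →
    let open CommutativeRing R in
    W (suc n) k - (ι R r - ι R n * lam) * W n k
      ≈ sumFromTo R (k ∸ 1) n (λ l → ι R (n C l) * fallingλ R (ι R m) lam (n ∸ l) * Wpred R W l k)
theorem16 R char0 nzd m 1≤m r lam W isWhitney n k k≤n =
  trans (lhs≈rhs char0 nzd 1≤m k (s≤s (ℕ.m≤n⇒m≤1+n k≤n)))
        (sym (sumFromTo≈Σ< R (k ∸ 1) n _ k∸1≤1+n
               (λ l l<k∸1 → trans (*-congˡ (Wpred-vanishes k l<k∸1)) (zeroʳ _))))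
  where
  open CommutativeRing R
  open Whitney R m r lam W isWhitney n
  k∸1≤1+n : k ∸ 1 ≤ suc n
  k∸1≤1+n = ℕ.≤-trans (ℕ.m∸n≤m k 1) (ℕ.m≤n⇒m≤1+n k≤n)
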